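{- Let $r\ge 2$ be an integer. Then for every integer $n\ge 3r-5$, $$ \sum_{l=0}^{2r-3}(-1)^l\binom{2r-3}{l}\sum_{\substack{j_1+\cdots+j_r=n-2l\\ j_1,\dots,j_r\ge 1}}B_{j_1}\cdots B_{j_r} =\sum_{k=1}^{r-1}(-1)^{k-1}\frac{n-2k-r+3}{r-1}\binom{n-2k+1}{r-k-1}\binom{n-k-2r+3}{k-1}B_{n-2k-r+3}\,. $$
   Context: The balancing numbers $B_n$ are defined by $B_0=0$, $B_1=1$ and $B_n=6B_{n-1}-B_{n-2}$ for $n\ge 2$. The inner sum is over ordered $r$-tuples of positive integers with the indicated sum (empty, hence $0$, if there is none). Binomial coefficients $\binom{\gamma'}{\gamma}$ with $\gamma'<\gamma$ (nonnegative integers) are $0$. -}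

module Defs where

open import Data.Nat using (ℕ; zero; suc; _+_; _*_; _∸_; _≡ᵇ_)
open import Data.Nat.Combinatorics using (_C_)
open import Data.Bool using (if_then_else_)
open import Data.Integer as ℤ using (ℤ; +_)
open import Data.Rational as ℚ using (ℚ)
open import Data.List using (List; []; _∷_; map; concatMap; upTo; foldr)
open import Data.Vec using (Vec; []; _∷_)

B : ℕ → ℤ
B zero = + 0
B (suc zero) = + 1
B (suc (suc n)) = + 6 ℤ.* B (suc n) ℤ.- B n

Σℤ[_to_] : ℕ → ℕ → (ℕ → ℤ) → ℤ
Σℤ[ a to b ] f = foldr ℤ._+_ (+ 0) (map (λ i → f (a + i)) (upTo (suc b ∸ a)))

Σℚ[_to_] : ℕ → ℕ → (ℕ → ℚ) → ℚ
Σℚ[ a to b ] f = foldr ℚ._+_ ℚ.0ℚ (map (λ i → f (a + i)) (upTo (suc b ∸ a)))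

sgn : ℕ → ℤ
sgn l = ℤ.-1ℤ ℤ.^ l

compositions : (r m : ℕ) → List (Vec ℕ r)
compositions zero m = if m ≡ᵇ 0 then ([] ∷ []) else []
compositions (suc r) m =
  concatMap (λ i → map (λ v → suc i ∷ v) (compositions r (m ∸ suc i))) (upTo m)

prodB : ∀ {r} → Vec ℕ r → ℤ
prodB [] = + 1
prodB (j ∷ js) = B j ℤ.* prodB js

compSum : (r m : ℕ) → ℤ
compSum r m = foldr ℤ._+_ (+ 0) (map prodB (compositions r m))

-- Left-hand side: Σ_{l=0}^{2r-3} (-1)^l C(2r-3,l) Σ_{j₁+⋯+j_r = n-2l} B_{j₁}⋯B_{j_r}
-- (when 2l > n the inner sum is empty, i.e. 0; here n ∸ 2l = 0 and there
--  are no compositions of 0 into r ≥ 1 positive parts, so it is 0 as well)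
lhs : (r n : ℕ) → ℤ
lhs r n = Σℤ[ 0 to 2 * r ∸ 3 ] (λ l →
  if (n + 1 ∸ 2 * l) ≡ᵇ 0 then + 0
  else sgn l ℤ.* (+ ((2 * r ∸ 3) C l)) ℤ.* compSum r (n ∸ 2 * l))

-- Summand of the right-hand side (valid for r ≥ 2, n ≥ 3r-5, 1 ≤ k ≤ r-1):
-- (-1)^{k-1} (n-2k-r+3)/(r-1) C(n-2k+1, r-k-1) C(n-k-2r+3, k-1) B_{n-2k-r+3}
rhsTerm : (r n k : ℕ) → ℚ
rhsTerm zero n k = ℚ.0ℚ
rhsTerm (suc zero) n k = ℚ.0ℚ
rhsTerm r@(suc (suc m)) n k =
  (sgn (k ∸ 1) ℤ.* (+ (n + 3 ∸ (2 * k + r)))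
     ℤ.* (+ ((n + 1 ∸ 2 * k) C (r ∸ (k + 1))))
     ℤ.* (+ ((n + 3 ∸ (k + 2 * r)) C (k ∸ 1)))
     ℤ.* B (n + 3 ∸ (2 * k + r)))
  ℚ./ suc m

rhs : (r n : ℕ) → ℚ
rhs r n = Σℚ[ 1 to r ∸ 1 ] (rhsTerm r n)

module Submission where

-- Write r = s + 2 and n = 3s + 1 + e. The generating function B(x) = x / (1 - 6x + x²) of the balancing
-- numbers satisfies x² B′ = (1 - x²) B², hence x² (Bʳ)′ = r (1 - x²) Bʳ⁺¹. The left-hand side is the
-- coefficient of xⁿ in L_s = (1 - x²)^(2s+1) B^(s+2), and commuting x² d/dx with powers of 1 - x² yields
--   (s + 2) L_{s+1}(m + 3) = (m + 2) (L_s(m + 2) - L_s(m)) + 4 (s + 1) L_s(m).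
-- Multiplied by s + 1 and written as a sum over i + j = s, the right-hand side satisfies the same recurrence
-- term by term, by Pascal's rule and the absorption identities for binomial coefficients; for s = 0 both
-- sides equal e Bₑ.

open import Data.Bool using (Bool; true; false; if_then_else_)
open import Data.Integer using (ℤ; +_; -_; _+_; _-_; _*_; 0ℤ; 1ℤ; -1ℤ)
import Data.Integer.Properties as ℤ
open import Algebra.Properties.CommutativeSemigroup ℤ.+-commutativeSemigroup using (interchange)
open import Algebra.Properties.CommutativeSemigroup ℤ.*-commutativeSemigroup using (x∙yz≈y∙xz)
open import Data.Integer.Tactic.RingSolver using (solve-∀)
open import Data.List using (List; []; _∷_; map; foldr; upTo; applyUpTo; concatMap; _++_)
import Data.List.Properties as List
open import Data.Nat as ℕ using (ℕ; zero; suc; s≤s; z≤n)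
import Data.Nat.Properties as ℕ
open import Data.Nat.Combinatorics using (_C_; nCk+nC[k+1]≡[n+1]C[k+1]; nC1≡n; k>n⇒nCk≡0)
import Data.Nat.Tactic.RingSolver as ℕ-Solver
open import Data.Product using (∃; _×_; _,_; proj₁)
open import Data.Rational as ℚ using (_/_)
import Data.Rational.Properties as ℚ
open import Data.Rational.Unnormalised as ℚᵘ using (mkℚᵘ; *≡*)
import Data.Rational.Unnormalised.Properties as ℚᵘ
open import Data.Vec using (Vec)
open import Function using (_∘_; id)
open import Relation.Binary.PropositionalEquality
  using (_≡_; refl; sym; trans; cong; cong₂; subst; module ≡-Reasoning)

open import Defs

sumList : List ℤ → ℤ
sumList = foldr _+_ 0ℤ

∑ : ℕ → (ℕ → ℤ) → ℤ
∑ zero    f = 0ℤ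
∑ (suc n) f = f 0 + ∑ n (f ∘ suc)

sumList-map-upTo : ∀ n (f : ℕ → ℤ) → sumList (map f (upTo n)) ≡ ∑ n f
sumList-map-upTo n f = trans (cong sumList (List.map-applyUpTo id f n)) (go n f)
  where
  go : ∀ n (f : ℕ → ℤ) → sumList (applyUpTo f n) ≡ ∑ n f
  go zero    f = refl
  go (suc n) f = cong (_+_ (f 0)) (go n (f ∘ suc))

∑-cong : ∀ n {f g : ℕ → ℤ} → (∀ i → f i ≡ g i) → ∑ n f ≡ ∑ n g
∑-cong zero    f≡g = refl
∑-cong (suc n) f≡g = cong₂ _+_ (f≡g 0) (∑-cong n (f≡g ∘ suc))

∑-zero : ∀ n → ∑ n (λ _ → 0ℤ) ≡ 0ℤ
∑-zero zero    = refl
∑-zero (suc n) = trans (ℤ.+-identityˡ _) (∑-zero n)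

∑-distrib-+ : ∀ n (f g : ℕ → ℤ) → ∑ n (λ i → f i + g i) ≡ ∑ n f + ∑ n g
∑-distrib-+ zero    f g = refl
∑-distrib-+ (suc n) f g =
  trans (cong (_+_ (f 0 + g 0)) (∑-distrib-+ n (f ∘ suc) (g ∘ suc))) (interchange (f 0) (g 0) _ _)

∑-neg : ∀ n (f : ℕ → ℤ) → ∑ n (λ i → - f i) ≡ - ∑ n f
∑-neg zero    f = refl
∑-neg (suc n) f = trans (cong (_+_ (- f 0)) (∑-neg n (f ∘ suc))) (sym (ℤ.neg-distrib-+ (f 0) _))

∑-last : ∀ n (f : ℕ → ℤ) → ∑ (suc n) f ≡ ∑ n f + f n
∑-last zero    f = ℤ.+-comm (f 0) 0ℤ
∑-last (suc n) f = trans (cong (_+_ (f 0)) (∑-last n (f ∘ suc))) (sym (ℤ.+-assoc (f 0) _ _))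

/-distrib-+ : ∀ p q d → (p + q) / suc d ≡ p / suc d ℚ.+ q / suc d
/-distrib-+ p q d = ℚ.toℚᵘ-injective (begin
  ℚ.toℚᵘ ((p + q) / suc d)
    ≈⟨ ℚ.toℚᵘ-fromℚᵘ (mkℚᵘ (p + q) d) ⟩
  mkℚᵘ (p + q) d
    ≈⟨ *≡* (split p q (+ suc d)) ⟩
  mkℚᵘ p d ℚᵘ.+ mkℚᵘ q d
    ≈⟨ ℚᵘ.+-cong (ℚ.toℚᵘ-fromℚᵘ (mkℚᵘ p d)) (ℚ.toℚᵘ-fromℚᵘ (mkℚᵘ q d)) ⟨
  ℚ.toℚᵘ (p / suc d) ℚᵘ.+ ℚ.toℚᵘ (q / suc d)
    ≈⟨ ℚ.toℚᵘ-homo-+ (p / suc d) (q / suc d) ⟨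
  ℚ.toℚᵘ (p / suc d ℚ.+ q / suc d)
    ∎)
  where
  open ℚᵘ.≃-Reasoning
  split : ∀ p q d → (p + q) * (d * d) ≡ (p * d + q * d) * d
  split = solve-∀

sum-/ : ∀ (z : ℕ → ℤ) d (xs : List ℕ) →
  foldr ℚ._+_ ℚ.0ℚ (map (λ i → z i / suc d) xs) ≡ sumList (map z xs) / suc d
sum-/ z d []       = ℚ.fromℚᵘ-cong {mkℚᵘ 0ℤ 0} {mkℚᵘ 0ℤ d} (*≡* refl)
sum-/ z d (x ∷ xs) = trans (cong (z x / suc d ℚ.+_) (sum-/ z d xs)) (sym (/-distrib-+ (z x) _ d))

/1≡*/ : ∀ p d → p / 1 ≡ (+ suc d * p) / suc d
/1≡*/ p d = ℚ.fromℚᵘ-cong {mkℚᵘ p 0} {mkℚᵘ (+ suc d * p) d}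
  (*≡* (trans (ℤ.*-comm p (+ suc d)) (sym (ℤ.*-identityʳ _))))

-- Sequences are coefficient sequences of formal power series: _⋆_ is the Cauchy product,
-- shift is multiplication by x, θ = x d/dx, ∂ = x² d/dx and Δ is multiplication by 1 - x².
Seq : Set
Seq = ℕ → ℤ

infix 4 _≈_
_≈_ : Seq → Seq → Set
f ≈ g = ∀ m → f m ≡ g m

infixl 6 _⊕_ _⊖_
_⊕_ : Seq → Seq → Seq
(f ⊕ g) m = f m + g m

_⊖_ : Seq → Seq → Seq
(f ⊖ g) m = f m - g m

infixr 7 _•_
_•_ : ℤ → Seq → Seq
(c • f) m = c * f m

infixl 7 _⋆_
_⋆_ : Seq → Seq → Seq
(f ⋆ g) zero    = f 0 * g 0
(f ⋆ g) (suc m) = f 0 * g (suc m) + (f ∘ suc ⋆ g) m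

𝟏 : Seq
𝟏 zero    = 1ℤ
𝟏 (suc _) = 0ℤ

shift : Seq → Seq
shift f zero    = 0ℤ
shift f (suc m) = f m

θ : Seq → Seq
θ f m = + m * f m

∂ : Seq → Seq
∂ f = shift (θ f)

Δ : Seq → Seq
Δ f = f ⊖ shift (shift f)

shift-cong : ∀ {f g} → f ≈ g → shift f ≈ shift g
shift-cong f≈g zero    = refl
shift-cong f≈g (suc m) = f≈g m

Δ-cong : ∀ {f g} → f ≈ g → Δ f ≈ Δ g
Δ-cong f≈g m = cong₂ _-_ (f≈g m) (shift-cong (shift-cong f≈g) m)

⋆-congˡ : ∀ {f f′} g → f ≈ f′ → f ⋆ g ≈ f′ ⋆ g
⋆-congˡ g f≈f′ zero    = cong (_* g 0) (f≈f′ 0)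
⋆-congˡ g f≈f′ (suc m) = cong₂ _+_ (cong (_* g (suc m)) (f≈f′ 0)) (⋆-congˡ g (f≈f′ ∘ suc) m)

⋆-congʳ : ∀ f {g g′} → g ≈ g′ → f ⋆ g ≈ f ⋆ g′
⋆-congʳ f g≈g′ zero    = cong (f 0 *_) (g≈g′ 0)
⋆-congʳ f g≈g′ (suc m) = cong₂ _+_ (cong (f 0 *_) (g≈g′ (suc m))) (⋆-congʳ (f ∘ suc) g≈g′ m)

⋆-distribʳ-⊕ : ∀ f f′ g → (f ⊕ f′) ⋆ g ≈ f ⋆ g ⊕ f′ ⋆ g
⋆-distribʳ-⊕ f f′ g zero    = ℤ.*-distribʳ-+ (g 0) (f 0) (f′ 0)
⋆-distribʳ-⊕ f f′ g (suc m) =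
  trans (cong₂ _+_ (ℤ.*-distribʳ-+ (g (suc m)) (f 0) (f′ 0))
                   (⋆-distribʳ-⊕ (f ∘ suc) (f′ ∘ suc) g m))
        (interchange (f 0 * g (suc m)) (f′ 0 * g (suc m)) ((f ∘ suc ⋆ g) m) ((f′ ∘ suc ⋆ g) m))

⋆-distribʳ-⊖ : ∀ f f′ g → (f ⊖ f′) ⋆ g ≈ f ⋆ g ⊖ f′ ⋆ g
⋆-distribʳ-⊖ f f′ g zero    = distrib (f 0) (f′ 0) (g 0)
  where
  distrib : ∀ a b c → (a - b) * c ≡ a * c - b * c
  distrib = solve-∀
⋆-distribʳ-⊖ f f′ g (suc m) =
  trans (cong (_+_ ((f 0 - f′ 0) * g (suc m))) (⋆-distribʳ-⊖ (f ∘ suc) (f′ ∘ suc) g m))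
        (distrib (f 0) (f′ 0) (g (suc m)) _ _)
  where
  distrib : ∀ a b c d e → (a - b) * c + (d - e) ≡ a * c + d - (b * c + e)
  distrib = solve-∀

⋆-distribˡ-⊖ : ∀ f g g′ → f ⋆ (g ⊖ g′) ≈ f ⋆ g ⊖ f ⋆ g′
⋆-distribˡ-⊖ f g g′ zero    = distrib (f 0) (g 0) (g′ 0)
  where
  distrib : ∀ a b c → a * (b - c) ≡ a * b - a * c
  distrib = solve-∀
⋆-distribˡ-⊖ f g g′ (suc m) =
  trans (cong (_+_ (f 0 * (g (suc m) - g′ (suc m)))) (⋆-distribˡ-⊖ (f ∘ suc) g g′ m))
        (distrib (f 0) (g (suc m)) (g′ (suc m)) _ _)
  where
  distrib : ∀ a b c d e → a * (b - c) + (d - e) ≡ a * b + d - (a * c + e)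
  distrib = solve-∀

•-⋆ : ∀ c f g → (c • f) ⋆ g ≈ c • (f ⋆ g)
•-⋆ c f g zero    = ℤ.*-assoc c (f 0) (g 0)
•-⋆ c f g (suc m) =
  trans (cong₂ _+_ (ℤ.*-assoc c (f 0) (g (suc m))) (•-⋆ c (f ∘ suc) g m))
        (sym (ℤ.*-distribˡ-+ c _ _))

⋆-• : ∀ c f g → f ⋆ (c • g) ≈ c • (f ⋆ g)
⋆-• c f g zero    = x∙yz≈y∙xz (f 0) c (g 0)
⋆-• c f g (suc m) =
  trans (cong₂ _+_ (x∙yz≈y∙xz (f 0) c (g (suc m))) (⋆-• c (f ∘ suc) g m))
        (sym (ℤ.*-distribˡ-+ c _ _))

⋆-assoc : ∀ f g h → f ⋆ (g ⋆ h) ≈ (f ⋆ g) ⋆ h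
⋆-assoc f g h zero    = sym (ℤ.*-assoc (f 0) (g 0) (h 0))
⋆-assoc f g h (suc m) = begin
  f 0 * (g 0 * h (suc m) + (g ∘ suc ⋆ h) m) + (f ∘ suc ⋆ (g ⋆ h)) m
    ≡⟨ cong₂ _+_ (ℤ.*-distribˡ-+ (f 0) _ _) (⋆-assoc (f ∘ suc) g h m) ⟩
  f 0 * (g 0 * h (suc m)) + f 0 * (g ∘ suc ⋆ h) m + (f ∘ suc ⋆ g ⋆ h) m
    ≡⟨ cong (_+ (f ∘ suc ⋆ g ⋆ h) m)
            (cong₂ _+_ (sym (ℤ.*-assoc (f 0) _ _)) (sym (•-⋆ (f 0) (g ∘ suc) h m))) ⟩
  f 0 * g 0 * h (suc m) + ((f 0 • g ∘ suc) ⋆ h) m + (f ∘ suc ⋆ g ⋆ h) m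
    ≡⟨ ℤ.+-assoc (f 0 * g 0 * h (suc m)) _ _ ⟩
  f 0 * g 0 * h (suc m) + (((f 0 • g ∘ suc) ⋆ h) m + (f ∘ suc ⋆ g ⋆ h) m)
    ≡⟨ cong (_+_ (f 0 * g 0 * h (suc m))) (sym (⋆-distribʳ-⊕ (f 0 • g ∘ suc) (f ∘ suc ⋆ g) h m)) ⟩
  f 0 * g 0 * h (suc m) + (((f 0 • g ∘ suc) ⊕ (f ∘ suc ⋆ g)) ⋆ h) m
    ∎
  where open ≡-Reasoning

⋆-zeroˡ : ∀ g → (λ _ → 0ℤ) ⋆ g ≈ (λ _ → 0ℤ)
⋆-zeroˡ g zero    = refl
⋆-zeroˡ g (suc m) = trans (ℤ.+-identityˡ _) (⋆-zeroˡ g m)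

⋆-identityˡ : ∀ g → 𝟏 ⋆ g ≈ g
⋆-identityˡ g zero    = ℤ.*-identityˡ (g 0)
⋆-identityˡ g (suc m) = trans (cong₂ _+_ (ℤ.*-identityˡ (g (suc m))) (⋆-zeroˡ g m)) (ℤ.+-identityʳ _)

⋆-identityʳ : ∀ f → f ⋆ 𝟏 ≈ f
⋆-identityʳ f zero    = ℤ.*-identityʳ (f 0)
⋆-identityʳ f (suc m) =
  trans (cong₂ _+_ (ℤ.*-zeroʳ (f 0)) (⋆-identityʳ (f ∘ suc) m)) (ℤ.+-identityˡ _)

shift-⋆ : ∀ f g → shift f ⋆ g ≈ shift (f ⋆ g)
shift-⋆ f g zero    = refl
shift-⋆ f g (suc m) = ℤ.+-identityˡ _

⋆-shift : ∀ f g → f ⋆ shift g ≈ shift (f ⋆ g)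
⋆-shift f g zero          = ℤ.*-zeroʳ (f 0)
⋆-shift f g (suc zero)    = trans (cong (_+_ (f 0 * g 0)) (ℤ.*-zeroʳ (f 1))) (ℤ.+-identityʳ _)
⋆-shift f g (suc (suc m)) = cong (_+_ (f 0 * g (suc m))) (⋆-shift (f ∘ suc) g (suc m))

Δ-⋆ : ∀ f g → Δ f ⋆ g ≈ Δ (f ⋆ g)
Δ-⋆ f g m = trans (⋆-distribʳ-⊖ f (shift (shift f)) g m)
  (cong (_-_ ((f ⋆ g) m)) (trans (shift-⋆ (shift f) g m) (shift-cong (shift-⋆ f g) m)))

⋆-Δ : ∀ f g → f ⋆ Δ g ≈ Δ (f ⋆ g)
⋆-Δ f g m = trans (⋆-distribˡ-⊖ f g (shift (shift g)) m)
  (cong (_-_ ((f ⋆ g) m)) (trans (⋆-shift f (shift g) m) (shift-cong (⋆-shift f g) m)))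

θ-suc : ∀ f → θ f ∘ suc ≈ f ∘ suc ⊕ θ (f ∘ suc)
θ-suc f i = unfold (+ i) (f (suc i))
  where
  unfold : ∀ n x → (1ℤ + n) * x ≡ x + n * x
  unfold = solve-∀

θ-⋆ : ∀ f g → θ (f ⋆ g) ≈ θ f ⋆ g ⊕ f ⋆ θ g
θ-⋆ f g zero    = vanish (f 0) (g 0)
  where
  vanish : ∀ a b → 0ℤ * (a * b) ≡ 0ℤ * a * b + a * (0ℤ * b)
  vanish = solve-∀
θ-⋆ f g (suc m) = begin
  (1ℤ + + m) * (f 0 * g (suc m) + X)
    ≡⟨ expand (+ m) (f 0) (g (suc m)) X ⟩
  X + + m * X + f 0 * θ g (suc m)
    ≡⟨ cong (λ y → X + y + f 0 * θ g (suc m)) (θ-⋆ (f ∘ suc) g m) ⟩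
  X + ((θ (f ∘ suc) ⋆ g) m + (f ∘ suc ⋆ θ g) m) + f 0 * θ g (suc m)
    ≡⟨ regroup X _ _ (f 0 * θ g (suc m)) (f 0) (g (suc m)) ⟩
  0ℤ * f 0 * g (suc m) + (X + (θ (f ∘ suc) ⋆ g) m) + (f 0 * θ g (suc m) + (f ∘ suc ⋆ θ g) m)
    ≡⟨ cong (λ y → 0ℤ * f 0 * g (suc m) + y + (f ⋆ θ g) (suc m)) θf∘suc⋆g ⟨
  (θ f ⋆ g ⊕ f ⋆ θ g) (suc m)
    ∎
  where
  open ≡-Reasoning
  X = (f ∘ suc ⋆ g) m
  expand : ∀ n a b x → (1ℤ + n) * (a * b + x) ≡ x + n * x + a * ((1ℤ + n) * b)
  expand = solve-∀
  regroup : ∀ x y z w a b → x + (y + z) + w ≡ 0ℤ * a * b + (x + y) + (w + z)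
  regroup = solve-∀
  θf∘suc⋆g : (θ f ∘ suc ⋆ g) m ≡ X + (θ (f ∘ suc) ⋆ g) m
  θf∘suc⋆g = trans (⋆-congˡ g (θ-suc f) m) (⋆-distribʳ-⊕ (f ∘ suc) (θ (f ∘ suc)) g m)

shift-⊕ : ∀ f g → shift (f ⊕ g) ≈ shift f ⊕ shift g
shift-⊕ f g zero    = refl
shift-⊕ f g (suc m) = refl

∂-⋆ : ∀ f g → ∂ (f ⋆ g) ≈ ∂ f ⋆ g ⊕ f ⋆ ∂ g
∂-⋆ f g m = begin
  shift (θ (f ⋆ g)) m                     ≡⟨ shift-cong (θ-⋆ f g) m ⟩
  shift (θ f ⋆ g ⊕ f ⋆ θ g) m             ≡⟨ shift-⊕ (θ f ⋆ g) (f ⋆ θ g) m ⟩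
  shift (θ f ⋆ g) m + shift (f ⋆ θ g) m   ≡⟨ cong₂ _+_ (shift-⋆ (θ f) g m) (⋆-shift f (θ g) m) ⟨
  (∂ f ⋆ g ⊕ f ⋆ ∂ g) m                   ∎
  where open ≡-Reasoning

Δ^ : ℕ → Seq → Seq
Δ^ zero    f = f
Δ^ (suc k) f = Δ (Δ^ k f)

Δ^-cong : ∀ k {f g} → f ≈ g → Δ^ k f ≈ Δ^ k g
Δ^-cong zero    f≈g = f≈g
Δ^-cong (suc k) f≈g = Δ-cong (Δ^-cong k f≈g)

Δ^-suc : ∀ k f → Δ^ (suc k) f ≈ Δ^ k (Δ f)
Δ^-suc zero    f m = refl
Δ^-suc (suc k) f   = Δ-cong (Δ^-suc k f)

shift-• : ∀ c f → shift (c • f) ≈ c • shift f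
shift-• c f zero    = sym (ℤ.*-zeroʳ c)
shift-• c f (suc m) = refl

Δ-• : ∀ c f → Δ (c • f) ≈ c • Δ f
Δ-• c f m = trans (cong (_-_ (c * f m)) (trans (shift-cong (shift-• c f) m) (shift-• c (shift f) m)))
                  (factor c (f m) (shift (shift f) m))
  where
  factor : ∀ c x y → c * x - c * y ≡ c * (x - y)
  factor = solve-∀

Δ^-• : ∀ k c f → Δ^ k (c • f) ≈ c • Δ^ k f
Δ^-• zero    c f m = refl
Δ^-• (suc k) c f m = trans (Δ-cong (Δ^-• k c f) m) (Δ-• c (Δ^ k f) m)

Δ-⊕ : ∀ f g → Δ (f ⊕ g) ≈ Δ f ⊕ Δ g
Δ-⊕ f g m =
  trans (cong (_-_ (f m + g m)) (trans (shift-cong (shift-⊕ f g) m) (shift-⊕ (shift f) (shift g) m)))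
        (regroup (f m) (g m) (shift (shift f) m) (shift (shift g) m))
  where
  regroup : ∀ a b c d → a + b - (c + d) ≡ (a - c) + (b - d)
  regroup = solve-∀

Δ-shift : ∀ f → Δ (shift f) ≈ shift (Δ f)
Δ-shift f zero    = refl
Δ-shift f (suc m) = refl

shift³ : Seq → Seq
shift³ f = shift (shift (shift f))

Δ-∂ : ∀ g → Δ (∂ g) ≈ ∂ (Δ g) ⊕ + 2 • shift³ g
Δ-∂ g zero    = refl
Δ-∂ g (suc m) = at m
  where
  padded : ∀ n x → n * x - 0ℤ ≡ n * (x - 0ℤ) + + 2 * 0ℤ
  padded = solve-∀
  commute : ∀ n a b → (+ 2 + n) * a - n * b ≡ (+ 2 + n) * (a - b) + + 2 * b
  commute = solve-∀
  at : ∀ m → Δ (∂ g) (suc m) ≡ (∂ (Δ g) ⊕ + 2 • shift³ g) (suc m)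
  at zero          = padded 0ℤ (g 0)
  at (suc zero)    = padded 1ℤ (g 1)
  at (suc (suc k)) = commute (+ k) (g (suc (suc k))) (g k)

Δ^-∂ : ∀ k g → Δ^ (suc k) (∂ g) ≈ ∂ (Δ^ (suc k) g) ⊕ (+ 2 * + suc k) • shift³ (Δ^ k g)
Δ^-∂ zero    g m =
  trans (Δ-∂ g m) (cong (_+_ (∂ (Δ g) m)) (cong (_* shift³ g m) (sym (ℤ.*-identityʳ (+ 2)))))
Δ^-∂ (suc k) g m = begin
  Δ (Δ^ (suc k) (∂ g)) m
    ≡⟨ Δ-cong (Δ^-∂ k g) m ⟩
  Δ (∂ X ⊕ (+ 2 * + suc k) • shift³ Y) m
    ≡⟨ Δ-⊕ (∂ X) ((+ 2 * + suc k) • shift³ Y) m ⟩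
  Δ (∂ X) m + Δ ((+ 2 * + suc k) • shift³ Y) m
    ≡⟨ cong₂ _+_ (Δ-∂ X m) (Δ-• (+ 2 * + suc k) (shift³ Y) m) ⟩
  ∂ (Δ X) m + + 2 * shift³ X m + (+ 2 * + suc k) * Δ (shift³ Y) m
    ≡⟨ cong (λ y → ∂ (Δ X) m + + 2 * shift³ X m + (+ 2 * + suc k) * y) Δshift³ ⟩
  ∂ (Δ X) m + + 2 * shift³ X m + (+ 2 * + suc k) * shift³ X m
    ≡⟨ collect (∂ (Δ X) m) (shift³ X m) (+ k) ⟩
  ∂ (Δ X) m + (+ 2 * + suc (suc k)) * shift³ X m
    ∎
  where
  open ≡-Reasoning
  X = Δ^ (suc k) g
  Y = Δ^ k g
  Δshift³ : Δ (shift³ Y) m ≡ shift³ X m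
  Δshift³ = trans (Δ-shift (shift (shift Y)) m)
    (shift-cong (λ i → trans (Δ-shift (shift Y) i) (shift-cong (Δ-shift Y) i)) m)
  collect : ∀ a x n → a + + 2 * x + + 2 * (1ℤ + n) * x ≡ a + + 2 * (1ℤ + (1ℤ + n)) * x
  collect = solve-∀

infixr 8 _^⋆_
_^⋆_ : Seq → ℕ → Seq
f ^⋆ zero  = 𝟏
f ^⋆ suc r = f ⋆ f ^⋆ r

∂-^⋆ : ∀ f → ∂ f ≈ Δ (f ⋆ f) → ∀ r → ∂ (f ^⋆ r) ≈ + r • Δ (f ^⋆ suc r)
∂-^⋆ f riccati zero zero          = refl
∂-^⋆ f riccati zero (suc zero)    = refl
∂-^⋆ f riccati zero (suc (suc m)) = ℤ.*-zeroʳ (+ suc m)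
∂-^⋆ f riccati (suc r) m = begin
  ∂ (f ⋆ f ^⋆ r) m
    ≡⟨ ∂-⋆ f (f ^⋆ r) m ⟩
  (∂ f ⋆ f ^⋆ r) m + (f ⋆ ∂ (f ^⋆ r)) m
    ≡⟨ cong₂ _+_ (⋆-congˡ (f ^⋆ r) riccati m) (⋆-congʳ f (∂-^⋆ f riccati r) m) ⟩
  (Δ (f ⋆ f) ⋆ f ^⋆ r) m + (f ⋆ (+ r • Δ (f ^⋆ suc r))) m
    ≡⟨ cong₂ _+_ (Δ-⋆ (f ⋆ f) (f ^⋆ r) m)
                 (trans (⋆-• (+ r) f (Δ (f ^⋆ suc r)) m) (cong (+ r *_) (⋆-Δ f (f ^⋆ suc r) m))) ⟩
  Δ (f ⋆ f ⋆ f ^⋆ r) m + + r * Δ (f ^⋆ suc (suc r)) m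
    ≡⟨ cong (_+ + r * Δ (f ^⋆ suc (suc r)) m) (Δ-cong (⋆-assoc f f (f ^⋆ r)) m) ⟨
  Δ (f ^⋆ suc (suc r)) m + + r * Δ (f ^⋆ suc (suc r)) m
    ≡⟨ collect (Δ (f ^⋆ suc (suc r)) m) (+ r) ⟩
  (1ℤ + + r) * Δ (f ^⋆ suc (suc r)) m
    ∎
  where
  open ≡-Reasoning
  collect : ∀ x n → x + n * x ≡ (1ℤ + n) * x
  collect = solve-∀

-- Balancing numbers

balancing-recurrence-unique : (w : Seq) → w 0 ≡ 0ℤ → w 1 ≡ 0ℤ →
  (∀ m → w (2 ℕ.+ m) ≡ + 6 * w (1 ℕ.+ m) - w m) → ∀ m → w m ≡ 0ℤ
balancing-recurrence-unique w w₀ w₁ rec m = proj₁ (consecutive m)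
  where
  consecutive : ∀ m → w m ≡ 0ℤ × w (suc m) ≡ 0ℤ
  consecutive zero = w₀ , w₁
  consecutive (suc m) with consecutive m
  ... | wₘ , wₘ₊₁ = wₘ₊₁ , trans (rec m) (cong₂ (λ a b → + 6 * a - b) wₘ₊₁ wₘ)

charPoly : Seq
charPoly 0 = 1ℤ
charPoly 1 = - + 6
charPoly 2 = 1ℤ
charPoly (suc (suc (suc _))) = 0ℤ

charPoly-⋆ : ∀ w m → (charPoly ⋆ w) (2 ℕ.+ m) ≡ 1ℤ * w (2 ℕ.+ m) + (- + 6 * w (1 ℕ.+ m) + w m)
charPoly-⋆ w m = cong (λ x → 1ℤ * w (2 ℕ.+ m) + (- + 6 * w (1 ℕ.+ m) + x))
  (trans (⋆-congˡ w charPoly∘suc∘suc≈𝟏 m) (⋆-identityˡ w m))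
  where
  charPoly∘suc∘suc≈𝟏 : charPoly ∘ suc ∘ suc ≈ 𝟏
  charPoly∘suc∘suc≈𝟏 zero    = refl
  charPoly∘suc∘suc≈𝟏 (suc i) = refl

charPoly⋆B : charPoly ⋆ B ≈ shift 𝟏
charPoly⋆B zero          = refl
charPoly⋆B (suc zero)    = refl
charPoly⋆B (suc (suc m)) = trans (charPoly-⋆ B m) (cancel (B (suc m)) (B m))
  where
  cancel : ∀ x y → 1ℤ * (+ 6 * x - y) + (- + 6 * x + y) ≡ 0ℤ
  cancel = solve-∀

B⋆B-recurrence : ∀ m → (B ⋆ B) (2 ℕ.+ m) ≡ + 6 * (B ⋆ B) (1 ℕ.+ m) - (B ⋆ B) m + B (suc m)
B⋆B-recurrence m = solveFor ((B ⋆ B) (2 ℕ.+ m)) ((B ⋆ B) (1 ℕ.+ m)) ((B ⋆ B) m) (B (suc m)) (begin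
  1ℤ * (B ⋆ B) (2 ℕ.+ m) + (- + 6 * (B ⋆ B) (1 ℕ.+ m) + (B ⋆ B) m)
    ≡⟨ charPoly-⋆ (B ⋆ B) m ⟨
  (charPoly ⋆ (B ⋆ B)) (2 ℕ.+ m)
    ≡⟨ ⋆-assoc charPoly B B (2 ℕ.+ m) ⟩
  (charPoly ⋆ B ⋆ B) (2 ℕ.+ m)
    ≡⟨ ⋆-congˡ B charPoly⋆B (2 ℕ.+ m) ⟩
  (shift 𝟏 ⋆ B) (2 ℕ.+ m)
    ≡⟨ shift-⋆ 𝟏 B (2 ℕ.+ m) ⟩
  (𝟏 ⋆ B) (suc m)
    ≡⟨ ⋆-identityˡ B (suc m) ⟩
  B (suc m)
    ∎)
  where
  open ≡-Reasoning
  solveFor : ∀ a b c d → 1ℤ * a + (- + 6 * b + c) ≡ d → a ≡ + 6 * b - c + d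
  solveFor a b c .(1ℤ * a + (- + 6 * b + c)) refl = rearrange a b c
    where
    rearrange : ∀ a b c → a ≡ + 6 * b - c + (1ℤ * a + (- + 6 * b + c))
    rearrange = solve-∀

-- The difference of the two sides satisfies the balancing recurrence and vanishes at 0 and 1.
∂B≈Δ[B⋆B] : ∂ B ≈ Δ (B ⋆ B)
∂B≈Δ[B⋆B] m = ℤ.i-j≡0⇒i≡j _ _ (balancing-recurrence-unique (∂ B ⊖ Δ (B ⋆ B)) refl refl rec m)
  where
  c = B ⋆ B
  rec : ∀ m → (∂ B ⊖ Δ c) (2 ℕ.+ m) ≡ + 6 * (∂ B ⊖ Δ c) (1 ℕ.+ m) - (∂ B ⊖ Δ c) m
  rec zero          = refl
  rec (suc zero)    = refl
  rec (suc (suc m)) = step (+ m) (B (suc m)) (B (2 ℕ.+ m)) (c m) (c (1 ℕ.+ m)) _ (c (3 ℕ.+ m)) _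
                           (B⋆B-recurrence m) (B⋆B-recurrence (2 ℕ.+ m))
    where
    step : ∀ n b₁ b₂ c₀ c₁ c₂ c₃ c₄ →
      c₂ ≡ + 6 * c₁ - c₀ + b₁ → c₄ ≡ + 6 * c₃ - c₂ + (+ 6 * b₂ - b₁) →
      (+ 3 + n) * (+ 6 * b₂ - b₁) - (c₄ - c₂)
        ≡ + 6 * ((+ 2 + n) * b₂ - (c₃ - c₁)) - ((1ℤ + n) * b₁ - (c₂ - c₀))
    step n b₁ b₂ c₀ c₁ _ c₃ _ refl refl = identity n b₁ b₂ c₀ c₁ c₃
      where
      identity : ∀ n b₁ b₂ c₀ c₁ c₃ →
        let c₂ = + 6 * c₁ - c₀ + b₁
        in (+ 3 + n) * (+ 6 * b₂ - b₁) - (+ 6 * c₃ - c₂ + (+ 6 * b₂ - b₁) - c₂)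
             ≡ + 6 * ((+ 2 + n) * b₂ - (c₃ - c₁)) - ((1ℤ + n) * b₁ - (c₂ - c₀))
      identity = solve-∀

-- The left-hand side

sumList-++ : ∀ (xs ys : List ℤ) → sumList (xs ++ ys) ≡ sumList xs + sumList ys
sumList-++ []       ys = sym (ℤ.+-identityˡ _)
sumList-++ (x ∷ xs) ys = trans (cong (_+_ x) (sumList-++ xs ys)) (sym (ℤ.+-assoc x _ _))

sumList-concatMap : ∀ {A C : Set} (h : C → ℤ) (g : A → List C) (xs : List A) →
  sumList (map h (concatMap g xs)) ≡ sumList (map (λ a → sumList (map h (g a))) xs)
sumList-concatMap h g []       = refl
sumList-concatMap h g (x ∷ xs) =
  trans (cong sumList (List.map-++ h (g x) (concatMap g xs)))
        (trans (sumList-++ (map h (g x)) (map h (concatMap g xs)))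
               (cong (_+_ (sumList (map h (g x)))) (sumList-concatMap h g xs)))

sumList-prodB-cons : ∀ {r} j (vs : List (Vec ℕ r)) →
  sumList (map prodB (map (j Vec.∷_) vs)) ≡ B j * sumList (map prodB vs)
sumList-prodB-cons j []       = sym (ℤ.*-zeroʳ (B j))
sumList-prodB-cons j (v ∷ vs) =
  trans (cong (_+_ (B j * prodB v)) (sumList-prodB-cons j vs)) (sym (ℤ.*-distribˡ-+ (B j) (prodB v) _))

compSum-suc : ∀ r m → compSum (suc r) m ≡ ∑ m (λ i → B (suc i) * compSum r (m ℕ.∸ suc i))
compSum-suc r m = begin
  sumList (map prodB (concatMap _ (upTo m)))
    ≡⟨ sumList-concatMap prodB _ (upTo m) ⟩
  sumList (map _ (upTo m))
    ≡⟨ cong sumList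
            (List.map-cong (λ i → sumList-prodB-cons (suc i) (compositions r (m ℕ.∸ suc i))) (upTo m)) ⟩
  sumList (map (λ i → B (suc i) * compSum r (m ℕ.∸ suc i)) (upTo m))
    ≡⟨ sumList-map-upTo m _ ⟩
  ∑ m (λ i → B (suc i) * compSum r (m ℕ.∸ suc i))
    ∎
  where open ≡-Reasoning

⋆-as-∑ : ∀ f g m → (f ⋆ g) m ≡ ∑ (suc m) (λ i → f i * g (m ℕ.∸ i))
⋆-as-∑ f g zero    = sym (ℤ.+-identityʳ _)
⋆-as-∑ f g (suc m) = cong (_+_ (f 0 * g (suc m))) (⋆-as-∑ (f ∘ suc) g m)

compSum≡B^⋆ : ∀ r m → compSum r m ≡ (B ^⋆ r) m
compSum≡B^⋆ zero    zero    = refl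
compSum≡B^⋆ zero    (suc m) = refl
compSum≡B^⋆ (suc r) zero    = sym (ℤ.*-zeroˡ ((B ^⋆ r) 0))
compSum≡B^⋆ (suc r) (suc m) = begin
  compSum (suc r) (suc m)
    ≡⟨ compSum-suc r (suc m) ⟩
  ∑ (suc m) (λ i → B (suc i) * compSum r (m ℕ.∸ i))
    ≡⟨ ∑-cong (suc m) (λ i → cong (B (suc i) *_) (compSum≡B^⋆ r (m ℕ.∸ i))) ⟩
  ∑ (suc m) (λ i → B (suc i) * (B ^⋆ r) (m ℕ.∸ i))
    ≡⟨ ⋆-as-∑ (B ∘ suc) (B ^⋆ r) m ⟨
  (B ∘ suc ⋆ B ^⋆ r) m
    ≡⟨ ℤ.+-identityˡ _ ⟨
  (B ⋆ B ^⋆ r) (suc m)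
    ∎
  where open ≡-Reasoning

shift²^ : ℕ → Seq → Seq
shift²^ zero    f = f
shift²^ (suc l) f = shift (shift (shift²^ l f))

∑-shift² : ∀ K (c : ℕ → ℤ) f n →
  ∑ K (λ l → c l * shift²^ (suc l) f n) ≡ shift (shift (λ m → ∑ K (λ l → c l * shift²^ l f m))) n
∑-shift² K c f zero          = trans (∑-cong K (λ l → ℤ.*-zeroʳ (c l))) (∑-zero K)
∑-shift² K c f (suc zero)    = trans (∑-cong K (λ l → ℤ.*-zeroʳ (c l))) (∑-zero K)
∑-shift² K c f (suc (suc n)) = refl

-- Pascal's rule as (1 - T)^(K+1) = (1 - T)^K - T (1 - T)^K, where T g = g ∘ suc.
∑-pascal : ∀ K (g : ℕ → ℤ) →
  ∑ (2 ℕ.+ K) (λ l → sgn l * + (suc K C l) * g l)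
    ≡ ∑ (suc K) (λ l → sgn l * + (K C l) * g l) - ∑ (suc K) (λ l → sgn l * + (K C l) * g (suc l))
∑-pascal K g = begin
  G 0 + ∑ (suc K) (λ l → sgn (suc l) * + (suc K C suc l) * g (suc l))
    ≡⟨ cong (_+_ (G 0)) (trans (∑-cong (suc K) split) (∑-distrib-+ (suc K) (G ∘ suc) H)) ⟩
  G 0 + (∑ (suc K) (G ∘ suc) + ∑ (suc K) H)
    ≡⟨ ℤ.+-assoc (G 0) _ _ ⟨
  ∑ (2 ℕ.+ K) G + ∑ (suc K) H
    ≡⟨ cong (_+ ∑ (suc K) H) drop-last ⟩
  ∑ (suc K) G + ∑ (suc K) H
    ≡⟨ cong (_+_ (∑ (suc K) G)) (∑-neg (suc K) (λ l → sgn l * + (K C l) * g (suc l))) ⟩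
  ∑ (suc K) G - ∑ (suc K) (λ l → sgn l * + (K C l) * g (suc l))
    ∎
  where
  open ≡-Reasoning
  G : ℕ → ℤ
  G l = sgn l * + (K C l) * g l
  H : ℕ → ℤ
  H l = - (sgn l * + (K C l) * g (suc l))
  split : ∀ l → sgn (suc l) * + (suc K C suc l) * g (suc l) ≡ G (suc l) + H l
  split l = trans (cong (λ c → sgn (suc l) * + c * g (suc l)) (sym (nCk+nC[k+1]≡[n+1]C[k+1] K l)))
                  (distrib (sgn l) (+ (K C l)) (+ (K C suc l)) (g (suc l)))
    where
    distrib : ∀ s a b x → -1ℤ * s * (a + b) * x ≡ -1ℤ * s * b * x + - (s * a * x)
    distrib = solve-∀
  drop-last : ∑ (2 ℕ.+ K) G ≡ ∑ (suc K) G
  drop-last = begin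
    ∑ (2 ℕ.+ K) G                          ≡⟨ ∑-last (suc K) G ⟩
    ∑ (suc K) G + sgn (suc K) * + (K C suc K) * g (suc K)
      ≡⟨ cong (λ c → ∑ (suc K) G + sgn (suc K) * + c * g (suc K)) (k>n⇒nCk≡0 (ℕ.n<1+n K)) ⟩
    ∑ (suc K) G + sgn (suc K) * 0ℤ * g (suc K)
      ≡⟨ vanish (∑ (suc K) G) (sgn (suc K)) (g (suc K)) ⟩
    ∑ (suc K) G                            ∎
    where
    vanish : ∀ x s y → x + s * 0ℤ * y ≡ x
    vanish = solve-∀

Δ^-binomial : ∀ K f n → ∑ (suc K) (λ l → sgn l * + (K C l) * shift²^ l f n) ≡ Δ^ K f n
Δ^-binomial zero    f n = simplify (f n)
  where
  simplify : ∀ x → 1ℤ * 1ℤ * x + 0ℤ ≡ x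
  simplify = solve-∀
Δ^-binomial (suc K) f n = begin
  ∑ (2 ℕ.+ K) (λ l → sgn l * + (suc K C l) * shift²^ l f n)
    ≡⟨ ∑-pascal K (λ l → shift²^ l f n) ⟩
  ∑ (suc K) (λ l → sgn l * + (K C l) * shift²^ l f n)
    - ∑ (suc K) (λ l → sgn l * + (K C l) * shift²^ (suc l) f n)
    ≡⟨ cong₂ _-_ (Δ^-binomial K f n) (∑-shift² (suc K) (λ l → sgn l * + (K C l)) f n) ⟩
  Δ^ K f n - shift (shift (λ m → ∑ (suc K) (λ l → sgn l * + (K C l) * shift²^ l f m))) n
    ≡⟨ cong (_-_ (Δ^ K f n)) (shift-cong (shift-cong (Δ^-binomial K f)) n) ⟩
  Δ^ (suc K) f n
    ∎
  where open ≡-Reasoning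

guarded≡shift²^ : ∀ l f n →
  (if (suc n ℕ.∸ 2 ℕ.* l) ℕ.≡ᵇ 0 then 0ℤ else f (n ℕ.∸ 2 ℕ.* l)) ≡ shift²^ l f n
guarded≡shift²^ zero    f n = refl
guarded≡shift²^ (suc l) f n =
  subst (λ d → (if (suc n ℕ.∸ d) ℕ.≡ᵇ 0 then 0ℤ else f (n ℕ.∸ d)) ≡ shift²^ (suc l) f n)
        (sym (ℕ.*-suc 2 l)) (shift-twice (2 ℕ.* l) (guarded≡shift²^ l f) n)
  where
  shift-twice : ∀ d {h} →
    (∀ n → (if (suc n ℕ.∸ d) ℕ.≡ᵇ 0 then 0ℤ else f (n ℕ.∸ d)) ≡ h n) →
    ∀ n → (if (suc n ℕ.∸ (2 ℕ.+ d)) ℕ.≡ᵇ 0 then 0ℤ else f (n ℕ.∸ (2 ℕ.+ d))) ≡ shift (shift h) n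
  shift-twice d eq zero          = refl
  shift-twice d eq (suc zero)    rewrite ℕ.0∸n≡0 d = refl
  shift-twice d eq (suc (suc n)) = eq n

lhs≡Δ^ : ∀ r n → lhs r n ≡ Δ^ (2 ℕ.* r ℕ.∸ 3) (B ^⋆ r) n
lhs≡Δ^ r n = begin
  lhs r n
    ≡⟨ sumList-map-upTo (suc K) F ⟩
  ∑ (suc K) F
    ≡⟨ ∑-cong (suc K) term ⟩
  ∑ (suc K) (λ l → sgn l * + (K C l) * shift²^ l (B ^⋆ r) n)
    ≡⟨ Δ^-binomial K (B ^⋆ r) n ⟩
  Δ^ K (B ^⋆ r) n
    ∎
  where
  open ≡-Reasoning
  K = 2 ℕ.* r ℕ.∸ 3
  F : ℕ → ℤ
  F l = if (n ℕ.+ 1 ℕ.∸ 2 ℕ.* l) ℕ.≡ᵇ 0 then 0ℤ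
        else sgn l * + (K C l) * compSum r (n ℕ.∸ 2 ℕ.* l)
  pull : ∀ (b : Bool) x y → (if b then 0ℤ else x * y) ≡ x * (if b then 0ℤ else y)
  pull true  x y = sym (ℤ.*-zeroʳ x)
  pull false x y = refl
  term : ∀ l → F l ≡ sgn l * + (K C l) * shift²^ l (B ^⋆ r) n
  term l = trans (pull _ (sgn l * + (K C l)) _)
    (cong (sgn l * + (K C l) *_)
      (trans (cong₂ (λ a b → if (a ℕ.∸ 2 ℕ.* l) ℕ.≡ᵇ 0 then 0ℤ else b)
                    (ℕ.+-comm n 1) (compSum≡B^⋆ r (n ℕ.∸ 2 ℕ.* l)))
             (guarded≡shift²^ l (B ^⋆ r) n)))

∂-B^⋆ : ∀ r → ∂ (B ^⋆ r) ≈ + r • Δ (B ^⋆ suc r)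
∂-B^⋆ = ∂-^⋆ B ∂B≈Δ[B⋆B]

L : ℕ → Seq
L s = Δ^ (suc (s ℕ.+ s)) (B ^⋆ suc (suc s))

lhs≡L : ∀ s n → lhs (suc (suc s)) n ≡ L s n
lhs≡L s n =
  trans (lhs≡Δ^ (suc (suc s)) n) (cong (λ K → Δ^ K (B ^⋆ suc (suc s)) n) (cong (ℕ._∸ 3) (double s)))
  where
  double : ∀ s → 2 ℕ.* suc (suc s) ≡ 3 ℕ.+ suc (s ℕ.+ s)
  double = ℕ-Solver.solve-∀

suc•L : ∀ s → + suc s • L s ≈ Δ^ (s ℕ.+ s) (∂ (B ^⋆ suc s))
suc•L s m = begin
  + suc s * Δ^ (suc (s ℕ.+ s)) (B ^⋆ suc (suc s)) m
    ≡⟨ cong (+ suc s *_) (Δ^-suc (s ℕ.+ s) (B ^⋆ suc (suc s)) m) ⟩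
  + suc s * Δ^ (s ℕ.+ s) (Δ (B ^⋆ suc (suc s))) m
    ≡⟨ Δ^-• (s ℕ.+ s) (+ suc s) (Δ (B ^⋆ suc (suc s))) m ⟨
  Δ^ (s ℕ.+ s) (+ suc s • Δ (B ^⋆ suc (suc s))) m
    ≡⟨ Δ^-cong (s ℕ.+ s) (∂-B^⋆ (suc s)) m ⟨
  Δ^ (s ℕ.+ s) (∂ (B ^⋆ suc s)) m
    ∎
  where open ≡-Reasoning

L-zero : ∀ n → L 0 (suc n) ≡ + n * B n
L-zero n =
  trans (sym (ℤ.*-identityˡ (L 0 (suc n)))) (trans (suc•L 0 (suc n)) (cong (+ n *_) (⋆-identityʳ B n)))

L-suc : ∀ s m → + suc (suc s) * L (suc s) (3 ℕ.+ m)
              ≡ + (2 ℕ.+ m) * (L s (2 ℕ.+ m) - L s m) + + 2 * + suc (suc (s ℕ.+ s)) * L s m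
L-suc s m = begin
  + suc (suc s) * L (suc s) (3 ℕ.+ m)
    ≡⟨ suc•L (suc s) (3 ℕ.+ m) ⟩
  Δ^ (suc s ℕ.+ suc s) (∂ (B ^⋆ suc (suc s))) (3 ℕ.+ m)
    ≡⟨ cong (λ k → Δ^ k (∂ (B ^⋆ suc (suc s))) (3 ℕ.+ m)) (cong suc (ℕ.+-suc s s)) ⟩
  Δ^ (suc (suc (s ℕ.+ s))) (∂ (B ^⋆ suc (suc s))) (3 ℕ.+ m)
    ≡⟨ Δ^-∂ (suc (s ℕ.+ s)) (B ^⋆ suc (suc s)) (3 ℕ.+ m) ⟩
  + (2 ℕ.+ m) * (L s (2 ℕ.+ m) - L s m) + + 2 * + suc (suc (s ℕ.+ s)) * L s m
    ∎
  where open ≡-Reasoning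

-- Binomial coefficients

C-absorb : ∀ m k → suc k ℕ.* (suc m C suc k) ≡ suc m ℕ.* (m C k)
C-absorb zero    zero    = refl
C-absorb zero    (suc k) = ℕ.*-zeroʳ (suc (suc k))
C-absorb (suc m) zero    = trans (ℕ.*-identityˡ _) (trans (nC1≡n (suc (suc m))) (sym (ℕ.*-identityʳ _)))
C-absorb (suc m) (suc k) = begin
  suc (suc k) ℕ.* (suc (suc m) C suc (suc k))
    ≡⟨ cong (suc (suc k) ℕ.*_) (nCk+nC[k+1]≡[n+1]C[k+1] (suc m) (suc k)) ⟨
  suc (suc k) ℕ.* (suc m C suc k ℕ.+ suc m C suc (suc k))
    ≡⟨ ℕ.*-distribˡ-+ (suc (suc k)) (suc m C suc k) _ ⟩
  suc (suc k) ℕ.* (suc m C suc k) ℕ.+ suc (suc k) ℕ.* (suc m C suc (suc k))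
    ≡⟨ cong₂ (λ x y → suc m C suc k ℕ.+ x ℕ.+ y) (C-absorb m k) (C-absorb m (suc k)) ⟩
  suc m C suc k ℕ.+ suc m ℕ.* (m C k) ℕ.+ suc m ℕ.* (m C suc k)
    ≡⟨ ℕ.+-assoc (suc m C suc k) _ _ ⟩
  suc m C suc k ℕ.+ (suc m ℕ.* (m C k) ℕ.+ suc m ℕ.* (m C suc k))
    ≡⟨ cong (suc m C suc k ℕ.+_) (ℕ.*-distribˡ-+ (suc m) (m C k) _) ⟨
  suc m C suc k ℕ.+ suc m ℕ.* (m C k ℕ.+ m C suc k)
    ≡⟨ cong (λ x → suc m C suc k ℕ.+ suc m ℕ.* x) (nCk+nC[k+1]≡[n+1]C[k+1] m k) ⟩
  suc (suc m) ℕ.* (suc m C suc k)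
    ∎
  where open ≡-Reasoning

C-absorbℤ : ∀ m k → + suc k * + (suc m C suc k) ≡ + suc m * + (m C k)
C-absorbℤ m k = trans (sym (ℤ.pos-* (suc k) _)) (trans (cong +_ (C-absorb m k)) (ℤ.pos-* (suc m) _))

C-absorb-∸ : ∀ m k → + suc k * + (m C suc k) ≡ (+ m - + k) * + (m C k)
C-absorb-∸ m k = eliminate (+ k) (+ m) (+ (m C k)) (+ (m C suc k))
  (cong (λ c → + suc k * + c) (sym (nCk+nC[k+1]≡[n+1]C[k+1] m k)))
  (C-absorbℤ m k)
  where
  eliminate : ∀ k m x y {z} →
    z ≡ (1ℤ + k) * (x + y) → z ≡ (1ℤ + m) * x → (1ℤ + k) * y ≡ (m - k) * x
  eliminate k m x y refl h = trans (rearrange k x y) (trans (cong (_- (1ℤ + k) * x) h) (collect k m x))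
    where
    rearrange : ∀ k x y → (1ℤ + k) * y ≡ (1ℤ + k) * (x + y) - (1ℤ + k) * x
    rearrange = solve-∀
    collect : ∀ k m x → (1ℤ + m) * x - (1ℤ + k) * x ≡ (m - k) * x
    collect = solve-∀

-- The right-hand side

∑-antidiag : ℕ → (ℕ → ℕ → ℤ) → ℤ
∑-antidiag zero    t = t 0 0
∑-antidiag (suc s) t = t 0 (suc s) + ∑-antidiag s (t ∘ suc)

∑-antidiag-cong : ∀ s {t u : ℕ → ℕ → ℤ} →
  (∀ i j → t i j ≡ u i j) → ∑-antidiag s t ≡ ∑-antidiag s u
∑-antidiag-cong zero    t≡u = t≡u 0 0
∑-antidiag-cong (suc s) t≡u = cong₂ _+_ (t≡u 0 (suc s)) (∑-antidiag-cong s (t≡u ∘ suc))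

∑-antidiag-distrib-+ : ∀ s (t u : ℕ → ℕ → ℤ) →
  ∑-antidiag s (λ i j → t i j + u i j) ≡ ∑-antidiag s t + ∑-antidiag s u
∑-antidiag-distrib-+ zero    t u = refl
∑-antidiag-distrib-+ (suc s) t u =
  trans (cong (_+_ (t 0 (suc s) + u 0 (suc s))) (∑-antidiag-distrib-+ s (t ∘ suc) (u ∘ suc)))
        (interchange (t 0 (suc s)) (u 0 (suc s)) _ _)

∑-antidiag-level : ∀ s (c : ℕ → ℤ) (t : ℕ → ℕ → ℤ) →
  ∑-antidiag s (λ i j → c (i ℕ.+ j) * t i j) ≡ c s * ∑-antidiag s t
∑-antidiag-level zero    c t = refl
∑-antidiag-level (suc s) c t =
  trans (cong (_+_ (c (suc s) * t 0 (suc s))) (∑-antidiag-level s (c ∘ suc) (t ∘ suc)))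
        (sym (ℤ.*-distribˡ-+ (c (suc s)) _ _))

∑-antidiag-last : ∀ s (t : ℕ → ℕ → ℤ) →
  ∑-antidiag (suc s) t ≡ ∑-antidiag s (λ i j → t i (suc j)) + t (suc s) 0
∑-antidiag-last zero    t = refl
∑-antidiag-last (suc s) t =
  trans (cong (_+_ (t 0 (2 ℕ.+ s))) (∑-antidiag-last s (t ∘ suc))) (sym (ℤ.+-assoc (t 0 (2 ℕ.+ s)) _ _))

∑-antidiag-pascal : ∀ (t P Q : ℕ → ℕ → ℤ) (α β : ℕ → ℤ) →
  (∀ j → t 0 (suc j) ≡ α j * P 0 j) →
  (∀ i → t (suc i) 0 ≡ β i * Q i 0) →
  (∀ i j → t (suc i) (suc j) ≡ α (suc (i ℕ.+ j)) * P (suc i) j + β (suc (i ℕ.+ j)) * Q i (suc j)) →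
  ∀ s → ∑-antidiag (suc s) t ≡ α s * ∑-antidiag s P + β s * ∑-antidiag s Q
∑-antidiag-pascal t P Q α β left right inner zero    = cong₂ _+_ (left 0) (right 0)
∑-antidiag-pascal t P Q α β left right inner (suc s) = begin
  t 0 (2 ℕ.+ s) + ∑-antidiag (suc s) (t ∘ suc)
    ≡⟨ cong (_+_ (t 0 (2 ℕ.+ s))) (∑-antidiag-last s (t ∘ suc)) ⟩
  t 0 (2 ℕ.+ s) + (∑-antidiag s (λ i j → t (suc i) (suc j)) + t (2 ℕ.+ s) 0)
    ≡⟨ cong₂ (λ x y → x + (y + t (2 ℕ.+ s) 0)) (left (suc s)) (∑-antidiag-cong s inner) ⟩
  a * P 0 (suc s)
    + (∑-antidiag s (λ i j → α (suc (i ℕ.+ j)) * P (suc i) j + β (suc (i ℕ.+ j)) * Q i (suc j))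
       + t (2 ℕ.+ s) 0)
    ≡⟨ cong₂ (λ x y → a * P 0 (suc s) + (x + y)) inner-sum (right (suc s)) ⟩
  a * P 0 (suc s) + (a * ∑-antidiag s (P ∘ suc) + b * ∑-antidiag s (λ i j → Q i (suc j)) + b * Q (suc s) 0)
    ≡⟨ regroup a b (P 0 (suc s)) _ _ (Q (suc s) 0) ⟩
  a * (P 0 (suc s) + ∑-antidiag s (P ∘ suc)) + b * (∑-antidiag s (λ i j → Q i (suc j)) + Q (suc s) 0)
    ≡⟨ cong (λ x → a * ∑-antidiag (suc s) P + b * x) (∑-antidiag-last s Q) ⟨
  a * ∑-antidiag (suc s) P + b * ∑-antidiag (suc s) Q
    ∎
  where
  open ≡-Reasoning
  a = α (suc s)
  b = β (suc s)
  inner-sum : ∑-antidiag s (λ i j → α (suc (i ℕ.+ j)) * P (suc i) j + β (suc (i ℕ.+ j)) * Q i (suc j))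
            ≡ a * ∑-antidiag s (P ∘ suc) + b * ∑-antidiag s (λ i j → Q i (suc j))
  inner-sum = trans (∑-antidiag-distrib-+ s _ _)
    (cong₂ _+_ (∑-antidiag-level s (α ∘ suc) (P ∘ suc))
               (∑-antidiag-level s (β ∘ suc) (λ i j → Q i (suc j))))
  regroup : ∀ a b p x y q → a * p + (a * x + b * y + b * q) ≡ a * (p + x) + b * (y + q)
  regroup = solve-∀

-- (r - 1) times the k-th summand of the right-hand side for r = i + j + 2, k = i + 1 and n = index (i + j) e.
summand : ℕ → ℕ → ℕ → ℤ
summand i j e =
  sgn i * + (j ℕ.+ j ℕ.+ e) * + ((i ℕ.+ j ℕ.+ j ℕ.+ j ℕ.+ e) C j) * + ((j ℕ.+ e ℕ.∸ 1) C i) * B (j ℕ.+ j ℕ.+ e)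

index : ℕ → ℕ → ℕ
index s e = s ℕ.+ s ℕ.+ s ℕ.+ 1 ℕ.+ e

summand-≡ : ∀ i j e A N M →
  j ℕ.+ j ℕ.+ e ≡ A → i ℕ.+ j ℕ.+ j ℕ.+ j ℕ.+ e ≡ N → j ℕ.+ e ℕ.∸ 1 ≡ M →
  summand i j e ≡ sgn i * + A * + (N C j) * + (M C i) * B A
summand-≡ i j e _ _ _ refl refl refl = refl

summand-left : ∀ j e → + suc j * summand 0 (suc j) e ≡ + (2 ℕ.+ index j e) * summand 0 j (2 ℕ.+ e)
summand-left j e = begin
  + suc j * summand 0 (suc j) e
    ≡⟨ cong (+ suc j *_) (summand-≡ 0 (suc j) e A (suc N) (j ℕ.+ e) refl (top j e) refl) ⟩
  + suc j * (1ℤ * + A * + (suc N C suc j) * 1ℤ * B A)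
    ≡⟨ absorb (+ suc j) (+ suc N) (+ (suc N C suc j)) (+ (N C j)) (+ A) (B A) (C-absorbℤ N j) ⟩
  + suc N * (1ℤ * + A * + (N C j) * 1ℤ * B A)
    ≡⟨ cong₂ _*_ (cong +_ (coefficient j e)) (summand-≡ 0 j (2 ℕ.+ e) A N _ (weight j e) refl refl) ⟨
  + (2 ℕ.+ index j e) * summand 0 j (2 ℕ.+ e)
    ∎
  where
  open ≡-Reasoning
  A = suc j ℕ.+ suc j ℕ.+ e
  N = j ℕ.+ j ℕ.+ j ℕ.+ (2 ℕ.+ e)
  top : ∀ j e → suc j ℕ.+ suc j ℕ.+ suc j ℕ.+ e ≡ suc (j ℕ.+ j ℕ.+ j ℕ.+ (2 ℕ.+ e))
  top = ℕ-Solver.solve-∀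
  weight : ∀ j e → j ℕ.+ j ℕ.+ (2 ℕ.+ e) ≡ suc j ℕ.+ suc j ℕ.+ e
  weight = ℕ-Solver.solve-∀
  coefficient : ∀ j e → 2 ℕ.+ (j ℕ.+ j ℕ.+ j ℕ.+ 1 ℕ.+ e) ≡ suc (j ℕ.+ j ℕ.+ j ℕ.+ (2 ℕ.+ e))
  coefficient = ℕ-Solver.solve-∀
  absorb : ∀ p q x y a b → p * x ≡ q * y → p * (1ℤ * a * x * 1ℤ * b) ≡ q * (1ℤ * a * y * 1ℤ * b)
  absorb p q x y a b h = trans (pull p x a b) (trans (cong (_* (a * b)) h) (sym (pull q y a b)))
    where
    pull : ∀ p x a b → p * (1ℤ * a * x * 1ℤ * b) ≡ p * x * (a * b)
    pull = solve-∀

summand-right : ∀ i e → + suc i * summand (suc i) 0 e ≡ (+ suc i - + e) * summand i 0 e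
summand-right i zero    =
  vanish (+ suc i) (+ suc i - 0ℤ) (sgn (suc i) * 0ℤ * 1ℤ * + (0 C suc i)) (sgn i * 0ℤ * 1ℤ * + (0 C i))
  where
  vanish : ∀ p q x y → p * (x * 0ℤ) ≡ q * (y * 0ℤ)
  vanish = solve-∀
summand-right i (suc e) = begin
  + suc i * (-1ℤ * σ * + suc e * 1ℤ * + (e C suc i) * B (suc e))
    ≡⟨ expand (+ i) σ (+ e) (+ (e C suc i)) (B (suc e)) ⟩
  - (σ * + suc e * B (suc e)) * (+ suc i * + (e C suc i))
    ≡⟨ cong (- (σ * + suc e * B (suc e)) *_) (C-absorb-∸ e i) ⟩
  - (σ * + suc e * B (suc e)) * ((+ e - + i) * + (e C i))
    ≡⟨ collect (+ i) σ (+ e) (+ (e C i)) (B (suc e)) ⟩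
  (+ suc i - + suc e) * (σ * + suc e * 1ℤ * + (e C i) * B (suc e))
    ∎
  where
  open ≡-Reasoning
  σ = sgn i
  expand : ∀ i σ e v b →
    (1ℤ + i) * (-1ℤ * σ * (1ℤ + e) * 1ℤ * v * b) ≡ - (σ * (1ℤ + e) * b) * ((1ℤ + i) * v)
  expand = solve-∀
  collect : ∀ i σ e y b →
    - (σ * (1ℤ + e) * b) * ((e - i) * y) ≡ ((1ℤ + i) - (1ℤ + e)) * (σ * (1ℤ + e) * 1ℤ * y * b)
  collect = solve-∀

-- Clearing the denominators i + 1 and j + 1, the hypotheses eliminate U and V.
binomial-interior : ∀ i j e (X U Y V : ℤ) →
  + suc j * U ≡ (+ (i ℕ.+ j ℕ.+ j ℕ.+ j ℕ.+ 3 ℕ.+ e) - + j) * X →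
  + suc i * V ≡ (+ (j ℕ.+ e) - + i) * Y →
  + (suc i ℕ.+ suc j) * ((X + U) * V)
    ≡ + (2 ℕ.+ index (suc (i ℕ.+ j)) e) * (X * (Y + V)) - (+ suc (suc (i ℕ.+ j)) - + e) * (U * Y)
binomial-interior i j e X U Y V hU hV = ℤ.*-cancelˡ-≡ (+ suc i) _ _ (ℤ.*-cancelˡ-≡ (+ suc j) _ _ (begin
  + suc j * (+ suc i * (+ (suc i ℕ.+ suc j) * ((X + U) * V)))
    ≡⟨ expandˡ (+ i) (+ j) X U V ⟩
  before (+ suc j * U) (+ suc i * V)
    ≡⟨ cong₂ before hU hV ⟩
  before ((+ N - + j) * X) ((+ M - + i) * Y)
    ≡⟨ eliminated (+ i) (+ j) (+ e) X Y ⟩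
  after ((+ N - + j) * X) ((+ M - + i) * Y)
    ≡⟨ cong₂ after hU hV ⟨
  after (+ suc j * U) (+ suc i * V)
    ≡⟨ expandʳ (+ i) (+ j) α β X U Y V ⟨
  + suc j * (+ suc i * (α * (X * (Y + V)) - β * (U * Y)))
    ∎))
  where
  open ≡-Reasoning
  N = i ℕ.+ j ℕ.+ j ℕ.+ j ℕ.+ 3 ℕ.+ e
  M = j ℕ.+ e
  α = + (2 ℕ.+ index (suc (i ℕ.+ j)) e)
  β = + suc (suc (i ℕ.+ j)) - + e
  before : ℤ → ℤ → ℤ
  before u v = + (suc i ℕ.+ suc j) * (+ suc j * X + u) * v
  after : ℤ → ℤ → ℤ
  after u v = α * + suc j * X * (+ suc i * Y + v) - β * + suc i * u * Y
  expandˡ : ∀ i j x u v →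
    (1ℤ + j) * ((1ℤ + i) * ((1ℤ + i + (1ℤ + j)) * ((x + u) * v)))
      ≡ (1ℤ + i + (1ℤ + j)) * ((1ℤ + j) * x + (1ℤ + j) * u) * ((1ℤ + i) * v)
  expandˡ = solve-∀
  expandʳ : ∀ i j a b x u y v →
    (1ℤ + j) * ((1ℤ + i) * (a * (x * (y + v)) - b * (u * y)))
      ≡ a * (1ℤ + j) * x * ((1ℤ + i) * y + (1ℤ + i) * v) - b * (1ℤ + i) * ((1ℤ + j) * u) * y
  expandʳ = solve-∀
  eliminated : ∀ i j e x y →
    let k = 1ℤ + (i + j)
        n = i + j + j + j + + 3 + e
        m = j + e
    in (1ℤ + i + (1ℤ + j)) * ((1ℤ + j) * x + (n - j) * x) * ((m - i) * y)
         ≡ (+ 2 + (k + k + k + 1ℤ + e)) * (1ℤ + j) * x * ((1ℤ + i) * y + (m - i) * y)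
           - (1ℤ + k - e) * (1ℤ + i) * ((n - j) * x) * y
  eliminated = solve-∀

summand-interior : ∀ i j e →
  + (suc i ℕ.+ suc j) * summand (suc i) (suc j) e
    ≡ + (2 ℕ.+ index (suc (i ℕ.+ j)) e) * summand (suc i) j (2 ℕ.+ e)
      + (+ suc (suc (i ℕ.+ j)) - + e) * summand i (suc j) e
summand-interior i j e = begin
  + (suc i ℕ.+ suc j) * summand (suc i) (suc j) e
    ≡⟨ cong (+ (suc i ℕ.+ suc j) *_) s₁ ⟩
  + (suc i ℕ.+ suc j) * (-1ℤ * σ * a * (X + U) * V * b)
    ≡⟨ factor (+ (suc i ℕ.+ suc j)) σ a b (X + U) V ⟩
  - (σ * a * b) * (+ (suc i ℕ.+ suc j) * ((X + U) * V))
    ≡⟨ cong (- (σ * a * b) *_) (binomial-interior i j e X U Y V (C-absorb-∸ N j) (C-absorb-∸ M i)) ⟩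
  - (σ * a * b) * (α * (X * (Y + V)) - β * (U * Y))
    ≡⟨ distribute α β σ a b X U Y V ⟩
  α * (-1ℤ * σ * a * X * (Y + V) * b) + β * (σ * a * U * Y * b)
    ≡⟨ cong₂ (λ x y → α * x + β * y) s₂ s₃ ⟨
  α * summand (suc i) j (2 ℕ.+ e) + β * summand i (suc j) e
    ∎
  where
  open ≡-Reasoning
  A = suc j ℕ.+ suc j ℕ.+ e
  N = i ℕ.+ j ℕ.+ j ℕ.+ j ℕ.+ 3 ℕ.+ e
  M = j ℕ.+ e
  σ = sgn i
  a = + A
  b = B A
  X = + (N C j)
  U = + (N C suc j)
  Y = + (M C i)
  V = + (M C suc i)
  α = + (2 ℕ.+ index (suc (i ℕ.+ j)) e)
  β = + suc (suc (i ℕ.+ j)) - + e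
  top₁ : ∀ i j e → suc i ℕ.+ suc j ℕ.+ suc j ℕ.+ suc j ℕ.+ e ≡ suc (i ℕ.+ j ℕ.+ j ℕ.+ j ℕ.+ 3 ℕ.+ e)
  top₁ = ℕ-Solver.solve-∀
  top₂ : ∀ i j e → suc i ℕ.+ j ℕ.+ j ℕ.+ j ℕ.+ (2 ℕ.+ e) ≡ i ℕ.+ j ℕ.+ j ℕ.+ j ℕ.+ 3 ℕ.+ e
  top₂ = ℕ-Solver.solve-∀
  top₃ : ∀ i j e → i ℕ.+ suc j ℕ.+ suc j ℕ.+ suc j ℕ.+ e ≡ i ℕ.+ j ℕ.+ j ℕ.+ j ℕ.+ 3 ℕ.+ e
  top₃ = ℕ-Solver.solve-∀
  weight : ∀ j e → j ℕ.+ j ℕ.+ (2 ℕ.+ e) ≡ suc j ℕ.+ suc j ℕ.+ e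
  weight = ℕ-Solver.solve-∀
  s₁ : summand (suc i) (suc j) e ≡ -1ℤ * σ * a * (X + U) * V * b
  s₁ = trans (summand-≡ (suc i) (suc j) e A (suc N) M refl (top₁ i j e) refl)
             (cong (λ c → -1ℤ * σ * a * + c * V * b) (sym (nCk+nC[k+1]≡[n+1]C[k+1] N j)))
  s₂ : summand (suc i) j (2 ℕ.+ e) ≡ -1ℤ * σ * a * X * (Y + V) * b
  s₂ = trans (summand-≡ (suc i) j (2 ℕ.+ e) A N (suc M) (weight j e) (top₂ i j e)
                        (trans (cong (ℕ._∸ 1) (ℕ.+-suc j (suc e))) (ℕ.+-suc j e)))
             (cong (λ c → -1ℤ * σ * a * X * + c * b) (sym (nCk+nC[k+1]≡[n+1]C[k+1] M i)))
  s₃ : summand i (suc j) e ≡ σ * a * U * Y * b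
  s₃ = summand-≡ i (suc j) e A N M refl (top₃ i j e) refl
  factor : ∀ p σ a b w v → p * (-1ℤ * σ * a * w * v * b) ≡ - (σ * a * b) * (p * (w * v))
  factor = solve-∀
  distribute : ∀ α β σ a b x u y v → - (σ * a * b) * (α * (x * (y + v)) - β * (u * y))
                                       ≡ α * (-1ℤ * σ * a * x * (y + v) * b) + β * (σ * a * u * y * b)
  distribute = solve-∀

closedForm : ℕ → ℕ → ℤ
closedForm s e = ∑-antidiag s (λ i j → summand i j e)

closedForm-zero : ∀ e → closedForm 0 e ≡ + e * B e
closedForm-zero e = simplify (+ e) (B e)
  where
  simplify : ∀ x y → 1ℤ * x * 1ℤ * 1ℤ * y ≡ x * y
  simplify = solve-∀

closedForm-suc : ∀ s e → + suc s * closedForm (suc s) e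
  ≡ + (2 ℕ.+ index s e) * closedForm s (2 ℕ.+ e) + (+ suc s - + e) * closedForm s e
closedForm-suc s e =
  trans (sym (∑-antidiag-level (suc s) +_ (λ i j → summand i j e)))
        (∑-antidiag-pascal (λ i j → + (i ℕ.+ j) * summand i j e)
                           (λ i j → summand i j (2 ℕ.+ e)) (λ i j → summand i j e)
                           (λ l → + (2 ℕ.+ index l e)) (λ l → + suc l - + e)
                           (λ j → summand-left j e) right (λ i j → summand-interior i j e) s)
  where
  right : ∀ i → + (suc i ℕ.+ 0) * summand (suc i) 0 e ≡ (+ suc i - + e) * summand i 0 e
  right i = trans (cong (λ k → + k * summand (suc i) 0 e) (ℕ.+-identityʳ (suc i))) (summand-right i e)

L-closedForm : ∀ s e → + suc s * L s (index s e) ≡ closedForm s e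
L-closedForm zero    e = trans (ℤ.*-identityˡ _) (trans (L-zero e) (sym (closedForm-zero e)))
L-closedForm (suc s) e = ℤ.*-cancelˡ-≡ (+ suc s) _ _ (begin
  + suc s * (+ suc (suc s) * L (suc s) (index (suc s) e))
    ≡⟨ cong (λ m → + suc s * (+ suc (suc s) * L (suc s) m)) (index-suc s e) ⟩
  + suc s * (+ suc (suc s) * L (suc s) (3 ℕ.+ n))
    ≡⟨ cong (+ suc s *_) (L-suc s n) ⟩
  + suc s * (+ (2 ℕ.+ n) * (L s (2 ℕ.+ n) - L s n) + + 2 * + suc (suc (s ℕ.+ s)) * L s n)
    ≡⟨ distribute (+ suc s) (+ (2 ℕ.+ n)) (+ 2 * + suc (suc (s ℕ.+ s))) (L s (2 ℕ.+ n)) (L s n) ⟩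
  + (2 ℕ.+ n) * (+ suc s * L s (2 ℕ.+ n)) + (+ 2 * + suc (suc (s ℕ.+ s)) - + (2 ℕ.+ n)) * (+ suc s * L s n)
    ≡⟨ cong₂ (λ x y → + (2 ℕ.+ n) * x + (+ 2 * + suc (suc (s ℕ.+ s)) - + (2 ℕ.+ n)) * y)
             (trans (cong (λ m → + suc s * L s m) (index-+2 s e)) (L-closedForm s (2 ℕ.+ e)))
             (L-closedForm s e) ⟩
  + (2 ℕ.+ n) * closedForm s (2 ℕ.+ e) + (+ 2 * + suc (suc (s ℕ.+ s)) - + (2 ℕ.+ n)) * closedForm s e
    ≡⟨ cong (λ c → + (2 ℕ.+ n) * closedForm s (2 ℕ.+ e) + c * closedForm s e) (coefficient (+ s) (+ e)) ⟩
  + (2 ℕ.+ n) * closedForm s (2 ℕ.+ e) + (+ suc s - + e) * closedForm s e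
    ≡⟨ closedForm-suc s e ⟨
  + suc s * closedForm (suc s) e
    ∎)
  where
  open ≡-Reasoning
  n = index s e
  index-suc : ∀ s e → suc s ℕ.+ suc s ℕ.+ suc s ℕ.+ 1 ℕ.+ e ≡ 3 ℕ.+ (s ℕ.+ s ℕ.+ s ℕ.+ 1 ℕ.+ e)
  index-suc = ℕ-Solver.solve-∀
  index-+2 : ∀ s e → 2 ℕ.+ (s ℕ.+ s ℕ.+ s ℕ.+ 1 ℕ.+ e) ≡ s ℕ.+ s ℕ.+ s ℕ.+ 1 ℕ.+ (2 ℕ.+ e)
  index-+2 = ℕ-Solver.solve-∀
  distribute : ∀ c a k x y → c * (a * (x - y) + k * y) ≡ a * (c * x) + (k - a) * (c * y)
  distribute = solve-∀
  coefficient : ∀ s e → + 2 * (+ 2 + (s + s)) - (+ 2 + (s + s + s + 1ℤ + e)) ≡ 1ℤ + s - e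
  coefficient = solve-∀

-- rhsTerm r n k ≡ rhsNumerator r n k / (r ∸ 1) for r ≥ 2, by definition.
rhsNumerator : ℕ → ℕ → ℕ → ℤ
rhsNumerator r n k = sgn (k ℕ.∸ 1) * + (n ℕ.+ 3 ℕ.∸ (2 ℕ.* k ℕ.+ r))
  * + ((n ℕ.+ 1 ℕ.∸ 2 ℕ.* k) C (r ℕ.∸ (k ℕ.+ 1))) * + ((n ℕ.+ 3 ℕ.∸ (k ℕ.+ 2 ℕ.* r)) C (k ℕ.∸ 1))
  * B (n ℕ.+ 3 ℕ.∸ (2 ℕ.* k ℕ.+ r))

∸-≡ : ∀ {m n o} → m ≡ n ℕ.+ o → m ℕ.∸ n ≡ o
∸-≡ {n = n} {o} refl = ℕ.m+n∸m≡n n o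

rhsNumerator≡summand : ∀ i j e →
  rhsNumerator (suc (suc (i ℕ.+ j))) (index (i ℕ.+ j) e) (suc i) ≡ summand i j e
rhsNumerator≡summand i j e =
  reshape (j ℕ.+ j ℕ.+ e) (i ℕ.+ j ℕ.+ j ℕ.+ j ℕ.+ e) j (j ℕ.+ e ℕ.∸ 1)
          (∸-≡ {n = 2 ℕ.* suc i ℕ.+ suc (suc (i ℕ.+ j))} (weight i j e))
          (∸-≡ {n = 2 ℕ.* suc i} (top i j e))
          (∸-≡ {n = suc i ℕ.+ 1} (row i j)) column
  where
  reshape : ∀ A N c M → index (i ℕ.+ j) e ℕ.+ 3 ℕ.∸ (2 ℕ.* suc i ℕ.+ suc (suc (i ℕ.+ j))) ≡ A →
    index (i ℕ.+ j) e ℕ.+ 1 ℕ.∸ 2 ℕ.* suc i ≡ N → suc (suc (i ℕ.+ j)) ℕ.∸ (suc i ℕ.+ 1) ≡ c →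
    index (i ℕ.+ j) e ℕ.+ 3 ℕ.∸ (suc i ℕ.+ 2 ℕ.* suc (suc (i ℕ.+ j))) ≡ M →
    rhsNumerator (suc (suc (i ℕ.+ j))) (index (i ℕ.+ j) e) (suc i) ≡ sgn i * + A * + (N C c) * + (M C i) * B A
  reshape _ _ _ _ refl refl refl refl = refl
  weight : ∀ i j e → (i ℕ.+ j) ℕ.+ (i ℕ.+ j) ℕ.+ (i ℕ.+ j) ℕ.+ 1 ℕ.+ e ℕ.+ 3
                   ≡ 2 ℕ.* suc i ℕ.+ suc (suc (i ℕ.+ j)) ℕ.+ (j ℕ.+ j ℕ.+ e)
  weight = ℕ-Solver.solve-∀
  top : ∀ i j e →
    (i ℕ.+ j) ℕ.+ (i ℕ.+ j) ℕ.+ (i ℕ.+ j) ℕ.+ 1 ℕ.+ e ℕ.+ 1 ≡ 2 ℕ.* suc i ℕ.+ (i ℕ.+ j ℕ.+ j ℕ.+ j ℕ.+ e)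
  top = ℕ-Solver.solve-∀
  row : ∀ i j → suc (suc (i ℕ.+ j)) ≡ suc i ℕ.+ 1 ℕ.+ j
  row = ℕ-Solver.solve-∀
  column : index (i ℕ.+ j) e ℕ.+ 3 ℕ.∸ (suc i ℕ.+ 2 ℕ.* suc (suc (i ℕ.+ j))) ≡ j ℕ.+ e ℕ.∸ 1
  column = trans (cong₂ ℕ._∸_ (before i j e) (after i j))
                 (ℕ.[m+n]∸[m+o]≡n∸o (i ℕ.+ i ℕ.+ i ℕ.+ j ℕ.+ j ℕ.+ 4) (j ℕ.+ e) 1)
    where
    before : ∀ i j e →
      (i ℕ.+ j) ℕ.+ (i ℕ.+ j) ℕ.+ (i ℕ.+ j) ℕ.+ 1 ℕ.+ e ℕ.+ 3 ≡ i ℕ.+ i ℕ.+ i ℕ.+ j ℕ.+ j ℕ.+ 4 ℕ.+ (j ℕ.+ e)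
    before = ℕ-Solver.solve-∀
    after : ∀ i j → suc i ℕ.+ 2 ℕ.* suc (suc (i ℕ.+ j)) ≡ i ℕ.+ i ℕ.+ i ℕ.+ j ℕ.+ j ℕ.+ 4 ℕ.+ 1
    after = ℕ-Solver.solve-∀

∑≡∑-antidiag : ∀ s (u : ℕ → ℤ) (t : ℕ → ℕ → ℤ) →
  (∀ i j → i ℕ.+ j ≡ s → u i ≡ t i j) → ∑ (suc s) u ≡ ∑-antidiag s t
∑≡∑-antidiag zero    u t u≡t = trans (ℤ.+-identityʳ (u 0)) (u≡t 0 0 refl)
∑≡∑-antidiag (suc s) u t u≡t =
  cong₂ _+_ (u≡t 0 (suc s) refl)
            (∑≡∑-antidiag s (u ∘ suc) (t ∘ suc) (λ i j i+j≡s → u≡t (suc i) j (cong suc i+j≡s)))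

rhs≡closedForm : ∀ s e → rhs (suc (suc s)) (index s e) ≡ closedForm s e / suc s
rhs≡closedForm s e = begin
  foldr ℚ._+_ ℚ.0ℚ (map (λ i → u i / suc s) (upTo (suc s)))
    ≡⟨ sum-/ u s (upTo (suc s)) ⟩
  sumList (map u (upTo (suc s))) / suc s
    ≡⟨ cong (_/ suc s) (sumList-map-upTo (suc s) u) ⟩
  ∑ (suc s) u / suc s
    ≡⟨ cong (_/ suc s) (∑≡∑-antidiag s u (λ i j → summand i j e) u≡summand) ⟩
  closedForm s e / suc s
    ∎
  where
  open ≡-Reasoning
  u : ℕ → ℤ
  u i = rhsNumerator (suc (suc s)) (index s e) (suc i)
  u≡summand : ∀ i j → i ℕ.+ j ≡ s → u i ≡ summand i j e
  u≡summand i j i+j≡s =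
    subst (λ t → rhsNumerator (suc (suc t)) (index t e) (suc i) ≡ summand i j e) i+j≡s
          (rhsNumerator≡summand i j e)

index-onto : ∀ s n → 3 ℕ.* suc (suc s) ℕ.∸ 5 ℕ.≤ n → ∃ λ e → index s e ≡ n
index-onto s n 3r∸5≤n =
  n ℕ.∸ (s ℕ.+ s ℕ.+ s ℕ.+ 1) , ℕ.m+[n∸m]≡n (subst (ℕ._≤ n) (cong (ℕ._∸ 5) (triple s)) 3r∸5≤n)
  where
  triple : ∀ s → 3 ℕ.* suc (suc s) ≡ 5 ℕ.+ (s ℕ.+ s ℕ.+ s ℕ.+ 1)
  triple = ℕ-Solver.solve-∀

theorem3 : (r n : ℕ) → 2 ℕ.≤ r → 3 ℕ.* r ℕ.∸ 5 ℕ.≤ n → lhs r n / 1 ≡ rhs r n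
theorem3 (suc (suc s)) n (s≤s (s≤s z≤n)) 3r∸5≤n with index-onto s n 3r∸5≤n
... | e , refl = begin
  lhs (suc (suc s)) (index s e) / 1
    ≡⟨ /1≡*/ (lhs (suc (suc s)) (index s e)) s ⟩
  (+ suc s * lhs (suc (suc s)) (index s e)) / suc s
    ≡⟨ cong (λ x → (+ suc s * x) / suc s) (lhs≡L s (index s e)) ⟩
  (+ suc s * L s (index s e)) / suc s
    ≡⟨ cong (_/ suc s) (L-closedForm s e) ⟩
  closedForm s e / suc s
    ≡⟨ rhs≡closedForm s e ⟨
  rhs (suc (suc s)) (index s e)
    ∎
  where open ≡-Reasoning
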